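{- If $G$ is the line graph of some finite simple graph and $G$ has minimum degree $\delta(G)\ge 2$, then $\mathrm{Maj}(G)\le 8$.
   Context: Graphs are finite, simple and undirected. A strong majority vertex-coloring of a graph $G=(V,E)$ is a (not necessarily proper) map $c:V\to C$ into a set $C$ of colors such that for every vertex $v\in V$ and every color $\alpha\in C$, at most half of the neighbors of $v$ have color $\alpha$. The strong majority number $\mathrm{Maj}(G)$ is the least number of colors in such a coloring. -}

module Defs where

open import Data.Nat using (ℕ; _*_; _≤_; _<_)
open import Data.Fin using (Fin)
open import Data.Fin.Properties using (_≟_)
open import Data.Bool using (Bool; true; false; T)
open import Data.List using (List; length; filter; allFin)
open import Data.Product using (Σ; ∃; _×_; _,_; proj₁; proj₂)
open import Data.Sum using (_⊎_)
open import Relation.Nullary using (¬_)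
open import Relation.Nullary.Decidable using (does)
open import Relation.Binary.PropositionalEquality using (_≡_)
open import Function.Bundles using (_⇔_)
import Data.Fin as F

record Graph (n : ℕ) : Set where
  field
    adj   : Fin n → Fin n → Bool
    sym   : ∀ u v → adj u v ≡ adj v u
    loopless : ∀ v → adj v v ≡ false
open Graph public

Adj : ∀ {n} → Graph n → Fin n → Fin n → Set
Adj G u v = T (adj G u v)

neighbours : ∀ {n} → Graph n → Fin n → List (Fin n)
neighbours G v = filter (λ u → Data.Bool.Properties.T? (adj G v u)) (allFin _)
  where import Data.Bool.Properties

degree : ∀ {n} → Graph n → Fin n → ℕ
degree G v = length (neighbours G v)

MinDegreeAtLeast : ∀ {n} → Graph n → ℕ → Set
MinDegreeAtLeast G d = ∀ v → d ≤ degree G v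

colourCount : ∀ {n k} → Graph n → (Fin n → Fin k) → Fin n → Fin k → ℕ
colourCount G c v α = length (filter (λ u → c u ≟ α) (neighbours G v))

IsStrongMajorityColouring : ∀ {n k} → Graph n → (Fin n → Fin k) → Set
IsStrongMajorityColouring G c = ∀ v α → 2 * colourCount G c v α ≤ degree G v

MajAtMost : ∀ {n} → Graph n → ℕ → Set
MajAtMost {n} G k = Σ (Fin n → Fin k) λ c → IsStrongMajorityColouring G c

IsEdge : ∀ {m} → Graph m → Fin m × Fin m → Set
IsEdge H (a , b) = (a F.< b) × Adj H a b

ShareEndpoint : ∀ {m} → Fin m × Fin m → Fin m × Fin m → Set
ShareEndpoint (a , b) (c , d) = (a ≡ c ⊎ a ≡ d) ⊎ (b ≡ c ⊎ b ≡ d)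

-- G is (isomorphic to) the line graph L(H): there is a bijection φ from
-- V(G) onto E(H) such that distinct u, v are adjacent in G iff the edges
-- φ u, φ v share an endpoint.
IsLineGraphOf : ∀ {n m} → Graph n → Graph m → Set
IsLineGraphOf {n} {m} G H =
  Σ (Fin n → Fin m × Fin m) λ φ →
    (∀ v → IsEdge H (φ v)) ×
    (∀ u v → φ u ≡ φ v → u ≡ v) ×
    (∀ e → IsEdge H e → ∃ λ v → φ v ≡ e) ×
    (∀ u v → ¬ u ≡ v → (Adj G u v ⇔ ShareEndpoint (φ u) (φ v)))

IsLineGraph : ∀ {n} → Graph n → Set
IsLineGraph G = ∃ λ m → Σ (Graph m) λ H → IsLineGraphOf G H

-- View G as the line graph L(H): a vertex x of G is an edge with ends p x, q x of H, two vertices are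
-- adjacent iff their edges share an end, and deg x + 2 = d(p x) + d(q x) for the H-degree d. Call an
-- edge thin if one of its ends has H-degree 2. We colour the edges of H greedily with 8 colours and keep
-- the colouring balanced: at every vertex of H of degree at least 3 each colour is used on strictly fewer
-- than half of the edges, and every thin edge satisfies the majority condition among its coloured
-- neighbours. At the end a non-thin edge satisfies the majority condition because its neighbours of a
-- fixed colour are fewer than half at each end (an end of degree 1 contributes none).
--
-- A colour is blocked at an end a of the edge x about to be coloured if using it breaks the balance at a
-- or at a thin edge through a. Non-thin edges are coloured first, while no thin edge is coloured; then
-- each end blocks at most 3 colours. Thin edges are coloured second: the end of degree 2 blocks at most
-- 2 colours (its other edge has degree at least 2 in G, and at most two colours fill half of its
-- neighbourhood), and any other end at most 5. The bounds at an end of degree d ≥ 3 come from double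
-- counting: every blocked colour occurs about d/2 times at that end or among the far neighbours of its
-- thin edges, and both totals are below d. So some colour among 8 is never blocked.

module Submission where

open import Level using (Level; 0ℓ)
open import Data.Nat as ℕ
  using (ℕ; zero; suc; pred; _+_; _*_; _≤_; _<_; z≤n; s≤s; s≤s⁻¹; _≤?_; _<?_; >-nonZero)
open import Data.Nat.Properties hiding (_≟_)
open import Data.Nat.Tactic.RingSolver using (solve-∀)
open import Data.Bool using (if_then_else_; T)
open import Data.Bool.Properties using (T?)
open import Data.Fin using (Fin; zero; suc; toℕ)
open import Data.Fin.Properties using (_≟_; any?)
open import Data.Maybe using (Maybe; just; nothing)
open import Data.Maybe.Properties using (just-injective; ≡-dec)
open import Data.List using (List; []; _∷_; length; filter; tabulate; allFin)
open import Data.List.Relation.Unary.All using (All; []; _∷_; lookup)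
open import Data.List.Membership.Propositional.Properties using (∈-allFin)
open import Data.Product using (∃; _×_; _,_; proj₁; proj₂)
open import Data.Sum as Sum using (_⊎_; inj₁; inj₂)
open import Data.Vec.Functional using (updateAt)
open import Data.Vec.Functional.Properties using (updateAt-updates; updateAt-minimal)
open import Function using (_∘_; id)
open import Function.Bundles using (_⇔_; mk⇔; Equivalence)
open import Relation.Nullary using (Dec; yes; no; does; ¬_; contradiction; _⊎-dec_; _×-dec_; ¬?)
open import Relation.Unary using (Pred; Decidable; _⊆_; _≐_; ∁; _∩_; _∪_)
open import Relation.Unary.Properties using (∁?; _∩?_; _∪?_; U?)
open import Relation.Binary.PropositionalEquality
open import Algebra.Properties.Semiring.Sum +-*-semiring
  using (sum; sum-syntax; ∑-distrib-+; ∑-comm; sum-cong-≗; sum-remove; *-distribˡ-sum; sum-replicate-zero)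
open import Defs hiding (sym)

private variable
  ℓ ℓ′ ℓ″ : Level
  A B : Set ℓ″
  k n K : ℕ

-- Counting over Fin k

𝟙 : Dec A → ℕ
𝟙 A? = if does A? then 1 else 0

count : {P : Pred (Fin k) ℓ} → Decidable P → ℕ
count P? = sum (𝟙 ∘ P?)

sum-mono-≤ : {f g : Fin k → ℕ} → (∀ i → f i ≤ g i) → sum f ≤ sum g
sum-mono-≤ {zero}  _   = z≤n
sum-mono-≤ {suc k} f≤g = +-mono-≤ (f≤g zero) (sum-mono-≤ (f≤g ∘ suc))

term≤sum : (f : Fin k → ℕ) (i : Fin k) → f i ≤ sum f
term≤sum {suc k} f i = ≤-trans (m≤m+n (f i) _) (≤-reflexive (sym (sum-remove {i = i} f)))

𝟙-yes : A → (A? : Dec A) → 𝟙 A? ≡ 1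
𝟙-yes a (yes _) = refl
𝟙-yes a (no ¬a) = contradiction a ¬a

𝟙-no : ¬ A → (A? : Dec A) → 𝟙 A? ≡ 0
𝟙-no ¬a (no _)  = refl
𝟙-no ¬a (yes a) = contradiction a ¬a

𝟙-mono : (A → B) → (A? : Dec A) (B? : Dec B) → 𝟙 A? ≤ 𝟙 B?
𝟙-mono f (no _)  _       = z≤n
𝟙-mono f (yes a) (yes _) = ≤-refl
𝟙-mono f (yes a) (no ¬b) = contradiction (f a) ¬b

𝟙-∪∩ : (A? : Dec A) (B? : Dec B) → 𝟙 (A? ⊎-dec B?) + 𝟙 (A? ×-dec B?) ≡ 𝟙 A? + 𝟙 B?
𝟙-∪∩ (yes _) (yes _) = refl
𝟙-∪∩ (yes _) (no _)  = refl
𝟙-∪∩ (no _)  (yes _) = refl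
𝟙-∪∩ (no _)  (no _)  = refl

𝟙-split : (A? : Dec A) (B? : Dec B) → 𝟙 A? ≡ 𝟙 (A? ×-dec B?) + 𝟙 (A? ×-dec ¬? B?)
𝟙-split (yes _) (yes _) = refl
𝟙-split (yes _) (no _)  = refl
𝟙-split (no _)  _       = refl

𝟙-*-≤ : ∀ {s} (A? : Dec A) → (A → s ≤ 1) → 𝟙 A? * s ≤ 𝟙 A?
𝟙-*-≤ (yes a) s≤1 = ≤-trans (≤-reflexive (*-identityˡ _)) (s≤1 a)
𝟙-*-≤ (no _)  _   = z≤n

module _ {P : Pred (Fin k) ℓ} {Q : Pred (Fin k) ℓ′} (P? : Decidable P) (Q? : Decidable Q) where

  count-mono : P ⊆ Q → count P? ≤ count Q?
  count-mono P⊆Q = sum-mono-≤ (λ i → 𝟙-mono P⊆Q (P? i) (Q? i))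

  count-split : count P? ≡ count (P? ∩? Q?) + count (P? ∩? ∁? Q?)
  count-split = trans (sum-cong-≗ (λ i → 𝟙-split (P? i) (Q? i)))
                      (∑-distrib-+ (𝟙 ∘ (P? ∩? Q?)) (𝟙 ∘ (P? ∩? ∁? Q?)))

  count-∪∩ : count (P? ∪? Q?) + count (P? ∩? Q?) ≡ count P? + count Q?
  count-∪∩ = begin
    count (P? ∪? Q?) + count (P? ∩? Q?)             ≡⟨ ∑-distrib-+ (𝟙 ∘ (P? ∪? Q?)) (𝟙 ∘ (P? ∩? Q?)) ⟨
    sum (λ i → 𝟙 ((P? ∪? Q?) i) + 𝟙 ((P? ∩? Q?) i)) ≡⟨ sum-cong-≗ (λ i → 𝟙-∪∩ (P? i) (Q? i)) ⟩
    sum (λ i → 𝟙 (P? i) + 𝟙 (Q? i))                 ≡⟨ ∑-distrib-+ (𝟙 ∘ P?) (𝟙 ∘ Q?) ⟩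
    count P? + count Q?                             ∎
    where open ≡-Reasoning

  count-∪ : count (P? ∪? Q?) ≤ count P? + count Q?
  count-∪ = ≤-trans (m≤m+n _ _) (≤-reflexive count-∪∩)

count-cong : {P : Pred (Fin k) ℓ} {Q : Pred (Fin k) ℓ′} (P? : Decidable P) (Q? : Decidable Q) →
             P ≐ Q → count P? ≡ count Q?
count-cong P? Q? (P⊆Q , Q⊆P) = ≤-antisym (count-mono P? Q? P⊆Q) (count-mono Q? P? Q⊆P)

count-U : count (U? {A = Fin k}) ≡ k
count-U {zero}  = refl
count-U {suc k} = cong suc (count-U {k})

count-≡ : (x : Fin k) → count (_≟ x) ≡ 1
count-≡ {suc k} zero    = cong suc (sum-replicate-zero k)
count-≡ {suc k} (suc x) = count-≡ x

module _ {P : Pred (Fin k) ℓ} (P? : Decidable P) where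

  count-≡0 : (∀ i → ¬ P i) → count P? ≡ 0
  count-≡0 ¬P = trans (sum-cong-≗ (λ i → 𝟙-no (¬P i) (P? i))) (sum-replicate-zero k)

  count-remove : ∀ {x} → P x → count P? ≡ suc (count (P? ∩? ∁? (_≟ x)))
  count-remove {x} Px = trans (count-split P? (_≟ x)) (cong (_+ count (P? ∩? ∁? (_≟ x))) at-x)
    where
    at-x : count (P? ∩? (_≟ x)) ≡ 1
    at-x = trans (count-cong (P? ∩? (_≟ x)) (_≟ x) (proj₂ , λ { refl → Px , refl })) (count-≡ x)

  count-pos : ∀ {x} → P x → 0 < count P?
  count-pos Px = ≤-trans (s≤s z≤n) (≤-reflexive (sym (count-remove Px)))

  count-≤1⇒unique : count P? ≤ 1 → ∀ {x y} → P x → P y → y ≡ x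
  count-≤1⇒unique ≤1 {x} {y} Px Py with y ≟ x
  ... | yes y≡x = y≡x
  ... | no  y≢x = contradiction (begin
    2                                  ≡⟨ cong suc (count-≡ y) ⟨
    suc (count (_≟ y))                 ≤⟨ s≤s (count-mono (_≟ y) (P? ∩? ∁? (_≟ x)) λ { refl → Py , y≢x }) ⟩
    suc (count (P? ∩? ∁? (_≟ x)))      ≡⟨ count-remove Px ⟨
    count P?                           ≤⟨ ≤1 ⟩
    1                                  ∎) λ { (s≤s ()) }
    where open ≤-Reasoning

  count-∃ : 0 < count P? → ∃ P
  count-∃ 0<count with any? P?
  ... | yes ∃P = ∃P
  ... | no  ∄P = contradiction (count-≡0 (λ i Pi → ∄P (i , Pi))) (>⇒≢ 0<count)

  count≡1⇒∃! : count P? ≡ 1 → ∃ λ x → P x × ∀ {y} → P y → y ≡ x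
  count≡1⇒∃! count≡1 with count-∃ (≤-reflexive (sym count≡1))
  ... | x , Px = x , Px , count-≤1⇒unique (≤-reflexive count≡1) Px

  count-≤-sum : ∀ t (f : Fin k → ℕ) → (∀ i → P i → t ≤ f i) → t * count P? ≤ sum f
  count-≤-sum t f t≤f = ≤-trans (≤-reflexive (*-distribˡ-sum t (𝟙 ∘ P?))) (sum-mono-≤ bound)
    where
    bound : ∀ i → t * 𝟙 (P? i) ≤ f i
    bound i with P? i
    ... | yes Pi = ≤-trans (≤-reflexive (*-identityʳ t)) (t≤f i Pi)
    ... | no  _  = ≤-trans (≤-reflexive (*-zeroʳ t)) z≤n

count-<⇒∃∁ : {P : Pred (Fin k) ℓ} (P? : Decidable P) → count P? < k → ∃ (∁ P)
count-<⇒∃∁ {k = k} P? count<k = count-∃ (∁? P?) (+-cancelˡ-< (count P?) 0 _ (begin-strict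
  count P? + 0             ≡⟨ +-identityʳ _ ⟩
  count P?                 <⟨ count<k ⟩
  k                        ≡⟨ trans (sym (count-split U? P?)) count-U ⟨
  count P? + count (∁? P?) ∎))
  where open ≤-Reasoning

length-filter-tabulate : {P : Pred A ℓ} (P? : Decidable P) (f : Fin k → A) →
                         length (filter P? (tabulate f)) ≡ count (P? ∘ f)
length-filter-tabulate {k = zero}  P? f = refl
length-filter-tabulate {k = suc k} P? f with P? (f zero)
... | yes _ = cong suc (length-filter-tabulate P? (f ∘ suc))
... | no  _ = length-filter-tabulate P? (f ∘ suc)

filter-filter : {P : Pred A ℓ} {Q : Pred A ℓ′} (P? : Decidable P) (Q? : Decidable Q) (xs : List A) →
                filter Q? (filter P? xs) ≡ filter (P? ∩? Q?) xs
filter-filter P? Q? [] = refl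
filter-filter P? Q? (x ∷ xs) with P? x
... | no  _ = filter-filter P? Q? xs
... | yes _ with Q? x
...   | yes _ = cong (x ∷_) (filter-filter P? Q? xs)
...   | no  _ = filter-filter P? Q? xs

-- Partial colourings

PartialColouring : ℕ → ℕ → Set
PartialColouring n K = Fin n → Maybe (Fin K)

_[_↦_] : PartialColouring n K → Fin n → Fin K → PartialColouring n K
c [ x ↦ α ] = updateAt c x (λ _ → just α)

HasColour : PartialColouring n K → Fin K → Pred (Fin n) 0ℓ
HasColour c α y = c y ≡ just α

hasColour? : (c : PartialColouring n K) (α : Fin K) → Decidable (HasColour c α)
hasColour? c α y = ≡-dec _≟_ (c y) (just α)

Uncoloured : PartialColouring n K → Pred (Fin n) 0ℓ
Uncoloured c y = c y ≡ nothing

uncoloured? : (c : PartialColouring n K) → Decidable (Uncoloured c)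
uncoloured? c y = ≡-dec _≟_ (c y) nothing

Coloured : PartialColouring n K → Pred (Fin n) 0ℓ
Coloured c y = ∃ λ α → HasColour c α y

infix 4 _⊑_
_⊑_ : PartialColouring n K → PartialColouring n K → Set
c ⊑ c′ = ∀ {y α} → HasColour c α y → HasColour c′ α y

module _ {c : PartialColouring n K} {x : Fin n} {α : Fin K} where

  [↦]-colours : HasColour (c [ x ↦ α ]) α x
  [↦]-colours = updateAt-updates x c

  [↦]-elsewhere : ∀ {y} → y ≢ x → (c [ x ↦ α ]) y ≡ c y
  [↦]-elsewhere {y} = updateAt-minimal y x c

  ⊑-[↦] : Uncoloured c x → c ⊑ c [ x ↦ α ]
  ⊑-[↦] cx≡nothing {y} cy≡just with y ≟ x
  ... | yes refl = contradiction (trans (sym cx≡nothing) cy≡just) λ ()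
  ... | no  y≢x  = trans ([↦]-elsewhere y≢x) cy≡just

  module _ {P : Pred (Fin n) ℓ} (P? : Decidable P) (β : Fin K) where

    count-[↦]-≤suc : count (P? ∩? hasColour? (c [ x ↦ α ]) β) ≤ suc (count (P? ∩? hasColour? c β))
    count-[↦]-≤suc = begin
      count (P? ∩? hasColour? (c [ x ↦ α ]) β)
        ≤⟨ count-mono (P? ∩? hasColour? (c [ x ↦ α ]) β) (P? ∩? hasColour? c β ∪? (_≟ x)) old-or-x ⟩
      count (P? ∩? hasColour? c β ∪? (_≟ x))
        ≤⟨ count-∪ (P? ∩? hasColour? c β) (_≟ x) ⟩
      count (P? ∩? hasColour? c β) + count (_≟ x)
        ≡⟨ cong (count (P? ∩? hasColour? c β) +_) (count-≡ x) ⟩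
      count (P? ∩? hasColour? c β) + 1
        ≡⟨ +-comm _ 1 ⟩
      suc (count (P? ∩? hasColour? c β)) ∎
      where
      open ≤-Reasoning
      old-or-x : P ∩ HasColour (c [ x ↦ α ]) β ⊆ (P ∩ HasColour c β) ∪ (_≡ x)
      old-or-x {y} (Py , c′y≡β) with y ≟ x
      ... | yes y≡x = inj₂ y≡x
      ... | no  y≢x = inj₁ (Py , trans (sym ([↦]-elsewhere y≢x)) c′y≡β)

    count-[↦]-≤ : ¬ (P x × α ≡ β) → count (P? ∩? hasColour? (c [ x ↦ α ]) β) ≤ count (P? ∩? hasColour? c β)
    count-[↦]-≤ ¬Px×α≡β = count-mono (P? ∩? hasColour? (c [ x ↦ α ]) β) (P? ∩? hasColour? c β) old
      where
      old : P ∩ HasColour (c [ x ↦ α ]) β ⊆ P ∩ HasColour c β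
      old {y} (Py , c′y≡β) with y ≟ x
      ... | yes refl = contradiction (Py , just-injective (trans (sym [↦]-colours) c′y≡β)) ¬Px×α≡β
      ... | no  y≢x  = Py , trans (sym ([↦]-elsewhere y≢x)) c′y≡β

𝟙-colours : (A? : Dec A) (m : Maybe (Fin K)) →
            ∑[ α < K ] 𝟙 (A? ×-dec ≡-dec _≟_ m (just α)) + 𝟙 (A? ×-dec ≡-dec _≟_ m nothing) ≡ 𝟙 A?
𝟙-colours {K = K} (no _)  m        = trans (+-identityʳ _) (sum-replicate-zero K)
𝟙-colours {K = K} (yes _) nothing  = cong (_+ 1) (sum-replicate-zero K)
𝟙-colours         (yes _) (just j) =
  trans (+-identityʳ _) (trans (count-cong (j ≟_) (_≟ j) (sym , sym)) (count-≡ j))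

module _ {P : Pred (Fin n) ℓ} (P? : Decidable P) (c : PartialColouring n K) where

  ∑-count-colours : ∑[ α < K ] count (P? ∩? hasColour? c α) + count (P? ∩? uncoloured? c) ≡ count P?
  ∑-count-colours = begin
    ∑[ α < K ] ∑[ y < n ] f α y + count (P? ∩? uncoloured? c)
      ≡⟨ cong (_+ count (P? ∩? uncoloured? c)) (∑-comm f) ⟩
    ∑[ y < n ] ∑[ α < K ] f α y + count (P? ∩? uncoloured? c)
      ≡⟨ ∑-distrib-+ (λ y → ∑[ α < K ] f α y) _ ⟨
    ∑[ y < n ] (∑[ α < K ] f α y + 𝟙 ((P? ∩? uncoloured? c) y))
      ≡⟨ sum-cong-≗ (λ y → 𝟙-colours (P? y) (c y)) ⟩
    count P? ∎
    where
    open ≡-Reasoning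
    f : Fin K → Fin n → ℕ
    f α y = 𝟙 ((P? ∩? hasColour? c α) y)

  ∑-count-colours-≤ : ∑[ α < K ] count (P? ∩? hasColour? c α) ≤ count P?
  ∑-count-colours-≤ = ≤-trans (m≤m+n _ _) (≤-reflexive ∑-count-colours)

  ∑-count-colours-< : ∀ {x} → P x → Uncoloured c x → ∑[ α < K ] count (P? ∩? hasColour? c α) < count P?
  ∑-count-colours-< Px cx≡nothing =
    <-≤-trans (m<m+n _ (count-pos (P? ∩? uncoloured? c) (Px , cx≡nothing))) (≤-reflexive ∑-count-colours)

module Greedy {Inv : PartialColouring n K → Set ℓ} {S : Pred (Fin n) ℓ′} (S? : Decidable S)
  (extend : ∀ {c x} → S x → Uncoloured c x → Inv c → ∃ λ α → Inv (c [ x ↦ α ])) where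

  colour-list : (xs : List (Fin n)) {c : PartialColouring n K} → Inv c →
                ∃ λ c′ → Inv c′ × c ⊑ c′ × All (λ x → S x → Coloured c′ x) xs
  colour-list [] {c} inv = c , inv , id , []
  colour-list (x ∷ xs) {c} inv with c x in cx
  ... | just β =
    let c′ , inv′ , c⊑c′ , done = colour-list xs inv
    in  c′ , inv′ , c⊑c′ , (λ _ → β , c⊑c′ cx) ∷ done
  ... | nothing with S? x
  ...   | no ¬Sx =
    let c′ , inv′ , c⊑c′ , done = colour-list xs inv
    in  c′ , inv′ , c⊑c′ , (λ Sx → contradiction Sx ¬Sx) ∷ done
  ...   | yes Sx =
    let α , inv₁ = extend Sx cx inv
        c′ , inv′ , c₁⊑c′ , done = colour-list xs inv₁
    in  c′ , inv′ , (λ h → c₁⊑c′ (⊑-[↦] {c = c} {α = α} cx h)) ,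
        (λ _ → α , c₁⊑c′ ([↦]-colours {c = c})) ∷ done

  colour-all : {c : PartialColouring n K} → Inv c →
               ∃ λ c′ → Inv c′ × c ⊑ c′ × (∀ {x} → S x → Coloured c′ x)
  colour-all inv =
    let c′ , inv′ , c⊑c′ , done = colour-list (allFin _) inv
    in  c′ , inv′ , c⊑c′ , λ {x} → lookup done (∈-allFin x)

module Neighbourhood (G : Graph n) where

  infix 4 _~_ _~?_
  _~_ : Fin n → Fin n → Set
  _~_ = Adj G

  _~?_ : (x : Fin n) → Decidable (x ~_)
  x ~? y = T? (adj G x y)

  ~-irrefl : ∀ {x y} → x ~ y → x ≢ y
  ~-irrefl {x} x~x refl = subst T (loopless G x) x~x

  deg : Fin n → ℕ
  deg x = count (x ~?_)

  degree≡deg : ∀ x → degree G x ≡ deg x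
  degree≡deg x = length-filter-tabulate (x ~?_) id

  countAround : PartialColouring n K → Fin n → Fin K → ℕ
  countAround c x α = count ((x ~?_) ∩? hasColour? c α)

  colourCount≡countAround : (c : PartialColouring n K) (χ : Fin n → Fin K) → (∀ y → c y ≡ just (χ y)) →
                            ∀ x α → colourCount G χ x α ≡ countAround c x α
  colourCount≡countAround c χ c≡χ x α = begin
    colourCount G χ x α
      ≡⟨ cong length (filter-filter (x ~?_) χ≟α (allFin _)) ⟩
    length (filter ((x ~?_) ∩? χ≟α) (allFin _))
      ≡⟨ length-filter-tabulate ((x ~?_) ∩? χ≟α) id ⟩
    count ((x ~?_) ∩? χ≟α)
      ≡⟨ count-cong ((x ~?_) ∩? χ≟α) ((x ~?_) ∩? hasColour? c α) (to , from) ⟩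
    countAround c x α ∎
    where
    open ≡-Reasoning
    χ≟α : Decidable (λ y → χ y ≡ α)
    χ≟α y = χ y ≟ α
    to : ∀ {y} → x ~ y × χ y ≡ α → x ~ y × c y ≡ just α
    to (x~y , refl) = x~y , c≡χ _
    from : ∀ {y} → x ~ y × c y ≡ just α → x ~ y × χ y ≡ α
    from {y} (x~y , cy≡α) = x~y , just-injective (trans (sym (c≡χ y)) cy≡α)

  SaturatedAround : PartialColouring n K → Fin n → Pred (Fin K) 0ℓ
  SaturatedAround c x α = deg x < 2 * suc (countAround c x α)

  saturatedAround? : (c : PartialColouring n K) (x : Fin n) → Decidable (SaturatedAround c x)
  saturatedAround? c x α = deg x <? 2 * suc (countAround c x α)

  few-saturated-colours : ∀ {c : PartialColouring n K} {g x} → 2 ≤ deg g → g ~ x → Uncoloured c x →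
                          count (saturatedAround? c g) ≤ 2
  few-saturated-colours {c = c} {g} 2≤deg g~x cx≡nothing =
    *-cancelˡ-≤ (pred (deg g)) {{>-nonZero (pred-mono-≤ 2≤deg)}} (begin
      pred (deg g) * count (saturatedAround? c g)
        ≤⟨ count-≤-sum (saturatedAround? c g) _ _ half-full ⟩
      ∑[ α < _ ] (2 * countAround c g α)
        ≡⟨ *-distribˡ-sum 2 (countAround c g) ⟨
      2 * ∑[ α < _ ] countAround c g α
        ≤⟨ *-monoʳ-≤ 2 (<⇒≤pred (∑-count-colours-< (g ~?_) c g~x cx≡nothing)) ⟩
      2 * pred (deg g)
        ≡⟨ *-comm 2 (pred (deg g)) ⟩
      pred (deg g) * 2 ∎)
    where
    open ≤-Reasoning
    half-full : ∀ α → SaturatedAround c g α → pred (deg g) ≤ 2 * countAround c g α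
    half-full α sat = pred-mono-≤ (s≤s⁻¹ (≤-trans sat (≤-reflexive (*-suc 2 (countAround c g α)))))

-- Arithmetic of the bounds on blocked colours

3+r≤2*[1+s]⇒1+r≤2*s : ∀ {r s} → 3 + r ≤ 2 * suc s → 1 + r ≤ 2 * s
3+r≤2*[1+s]⇒1+r≤2*s {s = s} h = s≤s⁻¹ (s≤s⁻¹ (≤-trans h (≤-reflexive (*-suc 2 s))))

1+r≤2*s⇒1≤s : ∀ {r s} → 1 + r ≤ 2 * s → 1 ≤ s
1+r≤2*s⇒1≤s {s = suc s} _ = s≤s z≤n

3+r<2*[2+s]⇒1≤r⇒1≤s : ∀ {r s} → 3 + r < 2 * (2 + s) → 1 ≤ r → 1 ≤ s
3+r<2*[2+s]⇒1≤r⇒1≤s {s = zero}  (s≤s (s≤s (s≤s (s≤s r≤0)))) (s≤s z≤n) = contradiction r≤0 λ ()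
3+r<2*[2+s]⇒1≤r⇒1≤s {s = suc s} _ _ = s≤s z≤n

few-colours-≤3 : ∀ {r k s} → k ≤ s → (1 + r) * k ≤ 2 * s → s ≤ 2 + r → k ≤ 3
few-colours-≤3 {zero}          k≤s _     s≤2   = ≤-trans k≤s (≤-trans s≤2 (n≤1+n 2))
few-colours-≤3 {suc r} {k} {s} _   rk≤2s s≤3+r with k ≤? 3
... | yes k≤3 = k≤3
... | no  k≰3 = contradiction (begin
  2 * (3 + r) + suc (1 + 2 * r) ≡⟨ gap r ⟩
  (2 + r) * 4                   ≤⟨ *-monoʳ-≤ (2 + r) (≰⇒> k≰3) ⟩
  (2 + r) * k                   ≤⟨ rk≤2s ⟩
  2 * s                         ≤⟨ *-monoʳ-≤ 2 s≤3+r ⟩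
  2 * (3 + r)                   ∎) (m+1+n≰m (2 * (3 + r)))
  where
  open ≤-Reasoning
  gap : ∀ r → 2 * (3 + r) + suc (1 + 2 * r) ≡ (2 + r) * 4
  gap = solve-∀

few-colours-≤5 : ∀ {r k s t} → k ≤ s + t → (1 + r) * k ≤ 2 * (s + t) → (1 ≤ r → k ≤ s) →
                 s ≤ 2 + r → t ≤ 2 + r → k ≤ 5
few-colours-≤5 {zero}     k≤s+t _ _   s≤2 t≤2 = ≤-trans k≤s+t (≤-trans (+-mono-≤ s≤2 t≤2) (n≤1+n 4))
few-colours-≤5 {suc zero} _     _ k≤s s≤3 _   = ≤-trans (k≤s (s≤s z≤n)) (≤-trans s≤3 (m≤n+m 3 2))
few-colours-≤5 {suc (suc r)} {k} {s} {t} _ rk≤2[s+t] _ s≤4+r t≤4+r with k ≤? 5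
... | yes k≤5 = k≤5
... | no  k≰5 = contradiction (begin
  2 * ((4 + r) + (4 + r)) + suc (1 + 2 * r) ≡⟨ gap r ⟩
  (3 + r) * 6                               ≤⟨ *-monoʳ-≤ (3 + r) (≰⇒> k≰5) ⟩
  (3 + r) * k                               ≤⟨ rk≤2[s+t] ⟩
  2 * (s + t)                               ≤⟨ *-monoʳ-≤ 2 (+-mono-≤ s≤4+r t≤4+r) ⟩
  2 * ((4 + r) + (4 + r))                   ∎) (m+1+n≰m (2 * ((4 + r) + (4 + r))))
  where
  open ≤-Reasoning
  gap : ∀ r → 2 * ((4 + r) + (4 + r)) + suc (1 + 2 * r) ≡ (3 + r) * 6
  gap = solve-∀

-- Line graphs

module LineGraph {n m : ℕ} (G : Graph n) (H : Graph m) (L : IsLineGraphOf G H) where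

  open Neighbourhood G public

  p q : Fin n → Fin m
  p x = proj₁ (proj₁ L x)
  q x = proj₂ (proj₁ L x)

  private variable
    x y e : Fin n
    a b w : Fin m

  Incident : Fin m → Pred (Fin n) 0ℓ
  Incident a x = p x ≡ a ⊎ q x ≡ a

  Incident? : (a : Fin m) → Decidable (Incident a)
  Incident? a x = p x ≟ a ⊎-dec q x ≟ a

  -- The degree of a in H, counted through G.
  degᴴ : Fin m → ℕ
  degᴴ a = count (Incident? a)

  degᴴ-remove : Incident a x → degᴴ a ≡ suc (count (Incident? a ∩? ∁? (_≟ x)))
  degᴴ-remove {a = a} = count-remove (Incident? a)

  degᴴ-cases : Incident a x → degᴴ a ≡ 1 ⊎ degᴴ a ≡ 2 ⊎ 3 ≤ degᴴ a
  degᴴ-cases {a = a} Iax with degᴴ a | degᴴ-remove Iax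
  ... | 1                 | _ = inj₁ refl
  ... | 2                 | _ = inj₂ (inj₁ refl)
  ... | suc (suc (suc _)) | _ = inj₂ (inj₂ (s≤s (s≤s (s≤s z≤n))))

  Joins : Fin n → Fin m → Fin m → Set
  Joins x a b = (p x ≡ a × q x ≡ b) ⊎ (p x ≡ b × q x ≡ a)

  joins : ∀ x → Joins x (p x) (q x)
  joins x = inj₁ (refl , refl)

  by-symmetry : (R : Fin m → Fin m → Set ℓ) → (∀ {a b} → R a b → R b a) →
                R (p x) (q x) → Joins x a b → R a b
  by-symmetry R R-sym r (inj₁ (refl , refl)) = r
  by-symmetry R R-sym r (inj₂ (refl , refl)) = R-sym r

  joins-incident : Joins x a b → Incident a x × Incident b x
  joins-incident (inj₁ (px≡a , qx≡b)) = inj₁ px≡a , inj₂ qx≡b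
  joins-incident (inj₂ (px≡b , qx≡a)) = inj₂ qx≡a , inj₁ px≡b

  incident-joins : Incident a x → ∃ (Joins x a)
  incident-joins {x = x} (inj₁ px≡a) = q x , inj₁ (px≡a , refl)
  incident-joins {x = x} (inj₂ qx≡a) = p x , inj₂ (refl , qx≡a)

  ends-of : Joins x a b → Incident w x → w ≡ a ⊎ w ≡ b
  ends-of (inj₁ (refl , refl)) (inj₁ refl) = inj₁ refl
  ends-of (inj₁ (refl , refl)) (inj₂ refl) = inj₂ refl
  ends-of (inj₂ (refl , refl)) (inj₁ refl) = inj₂ refl
  ends-of (inj₂ (refl , refl)) (inj₂ refl) = inj₁ refl

  both-ends : Joins x a b → ∀ {y} → Incident a y → Incident b y → y ≡ x
  both-ends {x = x} = by-symmetry (λ a b → ∀ {y} → Incident a y → Incident b y → y ≡ x)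
                                  (λ at-a-b Iby Iay → at-a-b Iay Iby) at-p-q
    where
    p<q : ∀ z → toℕ (p z) < toℕ (q z)
    p<q z = proj₁ (proj₁ (proj₂ L) z)
    p≢q : p x ≢ q x
    p≢q = <⇒≢ (p<q x) ∘ cong toℕ
    at-p-q : Incident (p x) y → Incident (q x) y → y ≡ x
    at-p-q {y} (inj₁ py≡px) (inj₁ py≡qx) = contradiction (trans (sym py≡px) py≡qx) p≢q
    at-p-q {y} (inj₁ py≡px) (inj₂ qy≡qx) = proj₁ (proj₂ (proj₂ L)) y x (cong₂ _,_ py≡px qy≡qx)
    at-p-q {y} (inj₂ qy≡px) (inj₁ py≡qx) =
      contradiction (subst₂ (λ u v → toℕ u < toℕ v) py≡qx qy≡px (p<q y)) (<-asym (p<q x))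
    at-p-q {y} (inj₂ qy≡px) (inj₂ qy≡qx) = contradiction (trans (sym qy≡px) qy≡qx) p≢q

  ~⇔incident : x ≢ y → x ~ y ⇔ (Incident (p x) y ⊎ Incident (q x) y)
  ~⇔incident {x = x} {y = y} x≢y = mk⇔
    (Sum.map (Sum.map sym sym) (Sum.map sym sym) ∘ Equivalence.to share)
    (Equivalence.from share ∘ Sum.map (Sum.map sym sym) (Sum.map sym sym))
    where
    share : x ~ y ⇔ ShareEndpoint (proj₁ L x) (proj₁ L y)
    share = proj₂ (proj₂ (proj₂ (proj₂ L))) x y x≢y

  ~⇒incident : Joins x a b → x ~ y → Incident a y ⊎ Incident b y
  ~⇒incident {y = y} j x~y = by-symmetry (λ a b → Incident a y ⊎ Incident b y) Sum.swap
    (Equivalence.to (~⇔incident (~-irrefl x~y)) x~y) j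

  incident⇒~ : Incident a x → Incident a y → x ≢ y → x ~ y
  incident⇒~ {x = x} Iax Iay x≢y = Equivalence.from (~⇔incident x≢y) (at-end Iax)
    where
    at-end : Incident _ x → Incident (p x) _ ⊎ Incident (q x) _
    at-end (inj₁ refl) = inj₁ Iay
    at-end (inj₂ refl) = inj₂ Iay

  common-end : x ~ y → ∃ λ a → Incident a x × Incident a y
  common-end {x = x} x~y with ~⇒incident (joins x) x~y
  ... | inj₁ Ipy = p x , inj₁ refl , Ipy
  ... | inj₂ Iqy = q x , inj₂ refl , Iqy

  degree-joins : Joins x a b → deg x + 2 ≡ degᴴ a + degᴴ b
  degree-joins {x = x} {a = a} {b = b} j = begin
    deg x + 2
      ≡⟨ +-suc (deg x) 1 ⟩
    suc (deg x) + 1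
      ≡⟨ cong₂ _+_ around-x at-x ⟨
    count (Incident? a ∪? Incident? b) + count (Incident? a ∩? Incident? b)
      ≡⟨ count-∪∩ (Incident? a) (Incident? b) ⟩
    degᴴ a + degᴴ b ∎
    where
    open ≡-Reasoning
    Iax : Incident a x
    Iax = proj₁ (joins-incident j)
    Ibx : Incident b x
    Ibx = proj₂ (joins-incident j)
    to : (Incident a ∪ Incident b) ∩ ∁ (_≡ x) ⊆ (x ~_)
    to (inj₁ Iay , y≢x) = incident⇒~ Iax Iay (y≢x ∘ sym)
    to (inj₂ Iby , y≢x) = incident⇒~ Ibx Iby (y≢x ∘ sym)
    from : (x ~_) ⊆ (Incident a ∪ Incident b) ∩ ∁ (_≡ x)
    from x~y = ~⇒incident j x~y , ~-irrefl x~y ∘ sym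
    around-x : count (Incident? a ∪? Incident? b) ≡ suc (deg x)
    around-x = trans (count-remove (Incident? a ∪? Incident? b) (inj₁ Iax))
                     (cong suc (count-cong ((Incident? a ∪? Incident? b) ∩? ∁? (_≟ x)) (x ~?_) (to , from)))
    at-x : count (Incident? a ∩? Incident? b) ≡ 1
    at-x = trans (count-cong (Incident? a ∩? Incident? b) (_≟ x)
                   ((λ (Iay , Iby) → both-ends j Iay Iby) , λ { refl → Iax , Ibx }))
                 (count-≡ x)

  Thin : Pred (Fin n) 0ℓ
  Thin x = ∃ λ a → Incident a x × degᴴ a ≡ 2

  thin? : Decidable Thin
  thin? x = any? (λ a → Incident? a x ×-dec degᴴ a ℕ.≟ 2)

  deg-thin : Joins e a w → degᴴ w ≡ 2 → deg e ≡ degᴴ a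
  deg-thin {a = a} j dw≡2 = +-cancelʳ-≡ 2 _ (degᴴ a) (trans (degree-joins j) (cong (degᴴ a +_) dw≡2))

  OtherThinEdgeAt : Fin n → Fin m → Pred (Fin n) 0ℓ
  OtherThinEdgeAt x a e = Incident a e × e ≢ x × Thin e

  otherThinEdgeAt? : (x : Fin n) (a : Fin m) → Decidable (OtherThinEdgeAt x a)
  otherThinEdgeAt? x a e = Incident? a e ×-dec ¬? (e ≟ x) ×-dec thin? e

  thin-far-end : 3 ≤ degᴴ a → OtherThinEdgeAt x a e → ∃ λ w → Joins e a w × degᴴ w ≡ 2
  thin-far-end 3≤d (Iae , _ , b , Ibe , db≡2) with incident-joins Iae
  ... | w , j with ends-of j Ibe
  ...   | inj₁ refl = contradiction (≤-trans 3≤d (≤-reflexive db≡2)) λ { (s≤s (s≤s ())) }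
  ...   | inj₂ refl = w , j , db≡2

  FarNeighbour : Fin m → Fin n → Pred (Fin n) 0ℓ
  FarNeighbour a e y = e ~ y × ¬ Incident a y

  farNeighbour? : (a : Fin m) (e : Fin n) → Decidable (FarNeighbour a e)
  farNeighbour? a e = (e ~?_) ∩? ∁? (Incident? a)

  far-neighbour-at : Joins e a w → FarNeighbour a e y → Incident w y
  far-neighbour-at j (e~y , ¬Iay) with ~⇒incident j e~y
  ... | inj₁ Iay = contradiction Iay ¬Iay
  ... | inj₂ Iwy = Iwy

  few-far-neighbours : 3 ≤ degᴴ a → OtherThinEdgeAt x a e → count (farNeighbour? a e) ≤ 1
  few-far-neighbours {a = a} {e = e} 3≤d t with thin-far-end 3≤d t
  ... | w , j , dw≡2 = begin
    count (farNeighbour? a e)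
      ≤⟨ count-mono (farNeighbour? a e) (Incident? w ∩? ∁? (_≟ e)) at-w ⟩
    count (Incident? w ∩? ∁? (_≟ e))
      ≡⟨ suc-injective (trans (sym (degᴴ-remove (proj₂ (joins-incident j)))) dw≡2) ⟩
    1 ∎
    where
    open ≤-Reasoning
    at-w : FarNeighbour a e ⊆ Incident w ∩ ∁ (_≡ e)
    at-w far@(e~y , _) = far-neighbour-at j far , ~-irrefl e~y ∘ sym

  -- Balanced partial colourings and blocked colours

  private variable
    c : PartialColouring n K
    α : Fin K

  countAt : PartialColouring n K → Fin m → Fin K → ℕ
  countAt c a α = count (Incident? a ∩? hasColour? c α)

  countAtExcept : PartialColouring n K → Fin m → Fin n → Fin K → ℕ
  countAtExcept c a x α = count ((Incident? a ∩? ∁? (_≟ x)) ∩? hasColour? c α)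

  farCount : PartialColouring n K → Fin m → Fin n → Fin K → ℕ
  farCount c a e α = count (farNeighbour? a e ∩? hasColour? c α)

  record Balanced (c : PartialColouring n K) : Set where
    field
      at-vertex   : ∀ {a} α → 3 ≤ degᴴ a → 2 * countAt c a α < degᴴ a
      around-thin : ∀ {e} α → Thin e → 2 * countAround c e α ≤ deg e
  open Balanced

  balanced-empty : Balanced {K = K} (λ _ → nothing)
  at-vertex   balanced-empty {a} α 3≤d = subst (λ z → 2 * z < degᴴ a) (sym none) (≤-trans (s≤s z≤n) 3≤d)
    where
    none : countAt (λ _ → nothing) a α ≡ 0
    none = count-≡0 (Incident? a ∩? hasColour? (λ _ → nothing) α) λ { _ (_ , ()) }
  around-thin balanced-empty {e} α _ = subst (λ z → 2 * z ≤ deg e) (sym none) z≤n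
    where
    none : countAround (λ _ → nothing) e α ≡ 0
    none = count-≡0 ((e ~?_) ∩? hasColour? (λ _ → nothing) α) λ { _ (_ , ()) }

  SaturatedAt : PartialColouring n K → Fin m → Pred (Fin K) 0ℓ
  SaturatedAt c a α = 3 ≤ degᴴ a × degᴴ a ≤ 2 * suc (countAt c a α)

  saturatedAt? : (c : PartialColouring n K) (a : Fin m) → Decidable (SaturatedAt c a)
  saturatedAt? c a α = 3 ≤? degᴴ a ×-dec degᴴ a ≤? 2 * suc (countAt c a α)

  Blocked : PartialColouring n K → Fin n → Fin m → Pred (Fin K) 0ℓ
  Blocked c x a α = SaturatedAt c a α ⊎ ∃ λ e → OtherThinEdgeAt x a e × SaturatedAround c e α

  blocked? : (c : PartialColouring n K) (x : Fin n) (a : Fin m) → Decidable (Blocked c x a)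
  blocked? c x a α = saturatedAt? c a α ⊎-dec any? (λ e → otherThinEdgeAt? x a e ×-dec saturatedAround? c e α)

  Free : PartialColouring n K → Fin n → Pred (Fin K) 0ℓ
  Free c x α = ∀ {a} → Incident a x → ¬ Blocked c x a α

  extend-balanced : Balanced c → Uncoloured c x → Free c x α → Balanced (c [ x ↦ α ])
  at-vertex (extend-balanced {c = c} {x = x} {α = α} bal _ free) {a} β 3≤d with Incident? a x ×-dec α ≟ β
  ... | yes (Iax , refl) = ≤-<-trans (*-monoʳ-≤ 2 (count-[↦]-≤suc (Incident? a) α)) room
    where
    room : 2 * suc (countAt c a α) < degᴴ a
    room = ≰⇒> (λ d≤ → free Iax (inj₁ (3≤d , d≤)))
  ... | no ¬Iax×α≡β = ≤-<-trans (*-monoʳ-≤ 2 (count-[↦]-≤ (Incident? a) β ¬Iax×α≡β)) (at-vertex bal β 3≤d)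
  around-thin (extend-balanced {c = c} {x = x} {α = α} bal _ free) {e} β thin with (e ~? x) ×-dec α ≟ β
  ... | yes (e~x , refl) = ≤-trans (*-monoʳ-≤ 2 (count-[↦]-≤suc (e ~?_) α)) room
    where
    room : 2 * suc (countAround c e α) ≤ deg e
    room with common-end e~x
    ... | a , Iae , Iax = ≮⇒≥ (λ sat → free Iax (inj₂ (e , (Iae , ~-irrefl e~x , thin) , sat)))
  ... | no ¬e~x×α≡β = ≤-trans (*-monoʳ-≤ 2 (count-[↦]-≤ (e ~?_) β ¬e~x×α≡β)) (around-thin bal β thin)

  free-colour : {c : PartialColouring n K} → Joins x a b →
                count (blocked? c x a) + count (blocked? c x b) < K → ∃ (Free c x)
  free-colour {x = x} {a = a} {b = b} {c = c} j few
    with count-<⇒∃∁ (blocked? c x a ∪? blocked? c x b)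
                    (≤-<-trans (count-∪ (blocked? c x a) (blocked? c x b)) few)
  ... | α , unblocked = α , free
    where
    free : Free c x α
    free Iwx with ends-of j Iwx
    ... | inj₁ refl = unblocked ∘ inj₁
    ... | inj₂ refl = unblocked ∘ inj₂

  countAround-≤-ends : Joins x a b → countAround c x α ≤ countAtExcept c a x α + countAtExcept c b x α
  countAround-≤-ends {x = x} {a = a} {b = b} {c = c} {α = α} j = ≤-trans
    (≤-reflexive (count-split ((x ~?_) ∩? hasColour? c α) (Incident? a)))
    (+-mono-≤ (count-mono (((x ~?_) ∩? hasColour? c α) ∩? Incident? a)
                          ((Incident? a ∩? ∁? (_≟ x)) ∩? hasColour? c α) at-a)
              (count-mono (((x ~?_) ∩? hasColour? c α) ∩? ∁? (Incident? a))
                          ((Incident? b ∩? ∁? (_≟ x)) ∩? hasColour? c α) at-b))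
    where
    at-a : ((x ~_) ∩ HasColour c α) ∩ Incident a ⊆ (Incident a ∩ ∁ (_≡ x)) ∩ HasColour c α
    at-a ((x~y , col) , Iay) = (Iay , ~-irrefl x~y ∘ sym) , col
    at-b : ((x ~_) ∩ HasColour c α) ∩ ∁ (Incident a) ⊆ (Incident b ∩ ∁ (_≡ x)) ∩ HasColour c α
    at-b ((x~y , col) , ¬Iay) with ~⇒incident j x~y
    ... | inj₁ Iay = contradiction Iay ¬Iay
    ... | inj₂ Iby = (Iby , ~-irrefl x~y ∘ sym) , col

  balanced-at-end : Balanced c → Incident a x → degᴴ a ≢ 2 → 2 * countAtExcept c a x α < degᴴ a
  balanced-at-end {c = c} {a = a} {x = x} {α = α} bal Iax d≢2 with degᴴ-cases Iax
  ... | inj₁ d≡1        = subst (λ z → 2 * z < degᴴ a) (sym none) (≤-reflexive (sym d≡1))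
    where
    none : countAtExcept c a x α ≡ 0
    none = n≤0⇒n≡0 (≤-trans
      (count-mono ((Incident? a ∩? ∁? (_≟ x)) ∩? hasColour? c α) (Incident? a ∩? ∁? (_≟ x)) proj₁)
      (≤-reflexive (suc-injective (trans (sym (degᴴ-remove Iax)) d≡1))))
  ... | inj₂ (inj₁ d≡2) = contradiction d≡2 d≢2
  ... | inj₂ (inj₂ 3≤d) = ≤-<-trans
    (*-monoʳ-≤ 2 (count-mono ((Incident? a ∩? ∁? (_≟ x)) ∩? hasColour? c α) (Incident? a ∩? hasColour? c α)
                             λ ((Iay , _) , col) → Iay , col))
    (at-vertex bal α 3≤d)

  balanced⇒majority : Balanced c → ∀ x α → 2 * countAround c x α ≤ deg x
  balanced⇒majority {c = c} bal x α with thin? x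
  ... | yes thin = around-thin bal α thin
  ... | no ¬thin = +-cancelʳ-≤ 2 _ (deg x) (begin
    2 * countAround c x α + 2
      ≤⟨ +-monoˡ-≤ 2 (*-monoʳ-≤ 2 (countAround-≤-ends {c = c} (joins x))) ⟩
    2 * (at (p x) + at (q x)) + 2
      ≡⟨ regroup (at (p x)) (at (q x)) ⟩
    suc (2 * at (p x)) + suc (2 * at (q x))
      ≤⟨ +-mono-≤ (end (inj₁ refl)) (end (inj₂ refl)) ⟩
    degᴴ (p x) + degᴴ (q x)
      ≡⟨ degree-joins (joins x) ⟨
    deg x + 2 ∎)
    where
    open ≤-Reasoning
    at : Fin m → ℕ
    at a = countAtExcept c a x α
    end : Incident a x → 2 * at a < degᴴ a
    end {a = a} Iax = balanced-at-end bal Iax (λ d≡2 → ¬thin (a , Iax , d≡2))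
    regroup : ∀ u v → 2 * (u + v) + 2 ≡ suc (2 * u) + suc (2 * v)
    regroup = solve-∀

  -- Counting blocked colours

  blocked-at-leaf : degᴴ a ≡ 1 → Incident a x → count (blocked? c x a) ≡ 0
  blocked-at-leaf {a = a} {x = x} {c = c} d≡1 Iax = count-≡0 (blocked? c x a) unblocked
    where
    unblocked : ∀ α → ¬ Blocked c x a α
    unblocked α (inj₁ (3≤d , _)) = contradiction (≤-trans 3≤d (≤-reflexive d≡1)) λ { (s≤s ()) }
    unblocked α (inj₂ (e , (Iae , e≢x , _) , _)) =
      e≢x (count-≤1⇒unique (Incident? a) (≤-reflexive d≡1) Iax Iae)

  other-edge : degᴴ a ≡ 2 → Incident a x →
               ∃ λ g → (Incident a g × g ≢ x) × (∀ {e} → Incident a e × e ≢ x → e ≡ g)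
  other-edge {a = a} {x = x} d≡2 Iax =
    count≡1⇒∃! (Incident? a ∩? ∁? (_≟ x)) (suc-injective (trans (sym (degᴴ-remove Iax)) d≡2))

  blocked-at-degree-two : (∀ g → 2 ≤ deg g) → degᴴ a ≡ 2 → Incident a x → Uncoloured c x →
                          count (blocked? c x a) ≤ 2
  blocked-at-degree-two {a = a} {x = x} {c = c} δ≥2 d≡2 Iax cx≡nothing with other-edge d≡2 Iax
  ... | g , (Iag , g≢x) , unique = begin
    count (blocked? c x a)
      ≤⟨ count-mono (blocked? c x a) (saturatedAround? c g) via-g ⟩
    count (saturatedAround? c g)
      ≤⟨ few-saturated-colours {c = c} (δ≥2 g) (incident⇒~ Iag Iax g≢x) cx≡nothing ⟩
    2 ∎
    where
    open ≤-Reasoning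
    via-g : Blocked c x a ⊆ SaturatedAround c g
    via-g (inj₁ (3≤d , _)) = contradiction (≤-trans 3≤d (≤-reflexive d≡2)) λ { (s≤s (s≤s ())) }
    via-g (inj₂ (e , (Iae , e≢x , _) , sat)) = subst (λ z → SaturatedAround c z _) (unique (Iae , e≢x)) sat

  countAround-≤-at+far : countAround c e α ≤ countAt c a α + farCount c a e α
  countAround-≤-at+far {c = c} {e = e} {α = α} {a = a} = ≤-trans
    (≤-reflexive (count-split ((e ~?_) ∩? hasColour? c α) (Incident? a)))
    (+-mono-≤ (count-mono (((e ~?_) ∩? hasColour? c α) ∩? Incident? a) (Incident? a ∩? hasColour? c α)
                          λ ((_ , col) , Iay) → Iay , col)
              (count-mono (((e ~?_) ∩? hasColour? c α) ∩? ∁? (Incident? a))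
                          (farNeighbour? a e ∩? hasColour? c α)
                          λ ((e~y , col) , ¬Iay) → (e~y , ¬Iay) , col))

  saturated-thin-edge : 3 ≤ degᴴ a → OtherThinEdgeAt x a e → SaturatedAround c e α →
                        degᴴ a < 2 * suc (countAt c a α + farCount c a e α)
  saturated-thin-edge {a = a} {e = e} {c = c} {α = α} 3≤d t sat with thin-far-end 3≤d t
  ... | w , j , dw≡2 = begin-strict
    degᴴ a                                     ≡⟨ deg-thin j dw≡2 ⟨
    deg e                                      <⟨ sat ⟩
    2 * suc (countAround c e α)                ≤⟨ *-monoʳ-≤ 2 (s≤s (countAround-≤-at+far {c = c} {α = α})) ⟩
    2 * suc (countAt c a α + farCount c a e α) ∎
    where open ≤-Reasoning

  ThinUncoloured : PartialColouring n K → Set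
  ThinUncoloured c = ∀ {y} → Thin y → Uncoloured c y

  farCount-≡0 : ThinUncoloured c → 3 ≤ degᴴ a → OtherThinEdgeAt x a e → farCount c a e α ≡ 0
  farCount-≡0 {c = c} {a = a} {e = e} {α = α} thin-uncoloured 3≤d t with thin-far-end 3≤d t
  ... | w , j , dw≡2 = count-≡0 (farNeighbour? a e ∩? hasColour? c α) uncoloured
    where
    uncoloured : ∀ y → ¬ (FarNeighbour a e y × HasColour c α y)
    uncoloured y (far , cy≡α) with () ← trans (sym (thin-uncoloured (w , far-neighbour-at j far , dw≡2))) cy≡α

  blocked-at-big-end-≤3 : ThinUncoloured c → 3 ≤ degᴴ a → Incident a x → Uncoloured c x →
                          count (blocked? c x a) ≤ 3
  blocked-at-big-end-≤3 {c = c} {a = a} {x = x} thin-uncoloured 3≤d Iax cx≡nothing with m≤n⇒∃[o]m+o≡n 3≤d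
  ... | r , 3+r≡d = few-colours-≤3 k≤Σ rk≤2Σ Σ≤2+r
    where
    cE : Fin _ → ℕ
    cE = countAt c a
    from-d : ∀ {z} → degᴴ a ≤ z → 3 + r ≤ z
    from-d {z} = subst (_≤ z) (sym 3+r≡d)
    saturated : ∀ α → Blocked c x a α → 3 + r ≤ 2 * suc (cE α)
    saturated α (inj₁ (_ , d≤)) = from-d d≤
    saturated α (inj₂ (e , t , sat)) = from-d (<⇒≤ (subst (λ z → degᴴ a < 2 * suc z)
      (trans (cong (cE α +_) (farCount-≡0 {α = α} thin-uncoloured 3≤d t)) (+-identityʳ (cE α)))
      (saturated-thin-edge {c = c} 3≤d t sat)))
    k≤Σ : count (blocked? c x a) ≤ ∑[ α < _ ] cE α
    k≤Σ = ≤-trans (≤-reflexive (sym (*-identityˡ _))) (count-≤-sum (blocked? c x a) 1 cE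
      λ α b → 1+r≤2*s⇒1≤s (3+r≤2*[1+s]⇒1+r≤2*s (saturated α b)))
    rk≤2Σ : (1 + r) * count (blocked? c x a) ≤ 2 * ∑[ α < _ ] cE α
    rk≤2Σ = ≤-trans (count-≤-sum (blocked? c x a) (1 + r) (λ α → 2 * cE α)
                      λ α b → 3+r≤2*[1+s]⇒1+r≤2*s (saturated α b))
                    (≤-reflexive (sym (*-distribˡ-sum 2 cE)))
    Σ≤2+r : ∑[ α < _ ] cE α ≤ 2 + r
    Σ≤2+r = s≤s⁻¹ (subst (∑[ α < _ ] cE α <_) (sym 3+r≡d) (∑-count-colours-< (Incident? a) c Iax cx≡nothing))

  farCount-≤1 : 3 ≤ degᴴ a → OtherThinEdgeAt x a e → farCount c a e α ≤ 1
  farCount-≤1 {a = a} {e = e} {c = c} {α = α} 3≤d t =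
    ≤-trans (count-mono (farNeighbour? a e ∩? hasColour? c α) (farNeighbour? a e) proj₁)
            (few-far-neighbours 3≤d t)

  thinCount : PartialColouring n K → Fin n → Fin m → Fin K → ℕ
  thinCount c x a α = ∑[ e < n ] (𝟙 (otherThinEdgeAt? x a e) * farCount c a e α)

  farCount≤thinCount : OtherThinEdgeAt x a e → farCount c a e α ≤ thinCount c x a α
  farCount≤thinCount {x = x} {a = a} {e = e} {c = c} {α = α} t = begin
    farCount c a e α
      ≡⟨ *-identityˡ _ ⟨
    1 * farCount c a e α
      ≡⟨ cong (_* farCount c a e α) (𝟙-yes t (otherThinEdgeAt? x a e)) ⟨
    𝟙 (otherThinEdgeAt? x a e) * farCount c a e α
      ≤⟨ term≤sum (λ e′ → 𝟙 (otherThinEdgeAt? x a e′) * farCount c a e′ α) e ⟩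
    thinCount c x a α ∎
    where open ≤-Reasoning

  -- The far end of a thin edge at a has degree 2, so each thin edge adds at most one coloured far neighbour.
  ∑-thinCount : {c : PartialColouring n K} → 3 ≤ degᴴ a → Incident a x → ∑[ α < K ] thinCount c x a α < degᴴ a
  ∑-thinCount {K = K} {a = a} {x = x} {c = c} 3≤d Iax = begin-strict
    ∑[ α < K ] ∑[ e < n ] f α e
      ≡⟨ ∑-comm f ⟩
    ∑[ e < n ] ∑[ α < K ] f α e
      ≡⟨ sum-cong-≗ (λ e → *-distribˡ-sum (𝟙 (otherThinEdgeAt? x a e)) (farCount c a e)) ⟨
    ∑[ e < n ] (𝟙 (otherThinEdgeAt? x a e) * ∑[ α < K ] farCount c a e α)
      ≤⟨ sum-mono-≤ (λ e → 𝟙-*-≤ (otherThinEdgeAt? x a e) λ t →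
                             ≤-trans (∑-count-colours-≤ (farNeighbour? a e) c) (few-far-neighbours 3≤d t)) ⟩
    count (otherThinEdgeAt? x a)
      ≤⟨ count-mono (otherThinEdgeAt? x a) (Incident? a ∩? ∁? (_≟ x)) (λ (Iae , e≢x , _) → Iae , e≢x) ⟩
    count (Incident? a ∩? ∁? (_≟ x))
      <⟨ n<1+n _ ⟩
    suc (count (Incident? a ∩? ∁? (_≟ x)))
      ≡⟨ degᴴ-remove Iax ⟨
    degᴴ a
      ∎
    where
    open ≤-Reasoning
    f : Fin K → Fin n → ℕ
    f α e = 𝟙 (otherThinEdgeAt? x a e) * farCount c a e α

  blocked-at-big-end-≤5 : 3 ≤ degᴴ a → Incident a x → Uncoloured c x → count (blocked? c x a) ≤ 5
  blocked-at-big-end-≤5 {a = a} {x = x} {c = c} 3≤d Iax cx≡nothing with m≤n⇒∃[o]m+o≡n 3≤d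
  ... | r , 3+r≡d = few-colours-≤5 k≤Σκ rk≤2Σκ k≤ΣcE
                      (below-d (∑-count-colours-< (Incident? a) c Iax cx≡nothing))
                      (below-d (∑-thinCount {c = c} 3≤d Iax))
    where
    cE thin κ : Fin _ → ℕ
    cE = countAt c a
    thin = thinCount c x a
    κ α = cE α + thin α
    from-d : ∀ {z} → degᴴ a ≤ z → 3 + r ≤ z
    from-d {z} = subst (_≤ z) (sym 3+r≡d)
    from-d< : ∀ {z} → degᴴ a < z → 3 + r < z
    from-d< {z} = subst (_< z) (sym 3+r≡d)
    below-d : ∀ {z} → z < degᴴ a → z ≤ 2 + r
    below-d {z} z<d = s≤s⁻¹ (subst (z <_) (sym 3+r≡d) z<d)
    keys : ∀ α → Blocked c x a α → degᴴ a < 2 * (2 + cE α) × degᴴ a ≤ 2 * suc (κ α)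
    keys α (inj₁ (_ , d≤)) = ≤-<-trans d≤ (*-monoʳ-< 2 (n<1+n (suc (cE α)))) ,
                             ≤-trans d≤ (*-monoʳ-≤ 2 (s≤s (m≤m+n (cE α) (thin α))))
    keys α (inj₂ (e , t , sat)) =
      <-≤-trans d< (*-monoʳ-≤ 2 (s≤s (≤-trans (+-monoʳ-≤ (cE α) (farCount-≤1 {c = c} {α = α} 3≤d t))
                                              (≤-reflexive (+-comm (cE α) 1))))) ,
      <⇒≤ (<-≤-trans d< (*-monoʳ-≤ 2 (s≤s (+-monoʳ-≤ (cE α) (farCount≤thinCount {c = c} {α = α} t)))))
      where
      d< : degᴴ a < 2 * suc (cE α + farCount c a e α)
      d< = saturated-thin-edge {c = c} 3≤d t sat
    Σκ≡ : ∑[ α < _ ] κ α ≡ ∑[ α < _ ] cE α + ∑[ α < _ ] thin α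
    Σκ≡ = ∑-distrib-+ cE thin
    k≤Σκ : count (blocked? c x a) ≤ ∑[ α < _ ] cE α + ∑[ α < _ ] thin α
    k≤Σκ = ≤-trans (≤-reflexive (sym (*-identityˡ _))) (≤-trans (count-≤-sum (blocked? c x a) 1 κ
      λ α b → 1+r≤2*s⇒1≤s (3+r≤2*[1+s]⇒1+r≤2*s (from-d (proj₂ (keys α b)))))
      (≤-reflexive Σκ≡))
    rk≤2Σκ : (1 + r) * count (blocked? c x a) ≤ 2 * (∑[ α < _ ] cE α + ∑[ α < _ ] thin α)
    rk≤2Σκ = ≤-trans (count-≤-sum (blocked? c x a) (1 + r) (λ α → 2 * κ α)
                       λ α b → 3+r≤2*[1+s]⇒1+r≤2*s (from-d (proj₂ (keys α b))))
                     (≤-reflexive (trans (sym (*-distribˡ-sum 2 κ)) (cong (2 *_) Σκ≡)))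
    k≤ΣcE : 1 ≤ r → count (blocked? c x a) ≤ ∑[ α < _ ] cE α
    k≤ΣcE 1≤r = ≤-trans (≤-reflexive (sym (*-identityˡ _))) (count-≤-sum (blocked? c x a) 1 cE
      λ α b → 3+r<2*[2+s]⇒1≤r⇒1≤s (from-d< (proj₁ (keys α b))) 1≤r)

  blocked-≤5 : (∀ g → 2 ≤ deg g) → Incident a x → Uncoloured c x → count (blocked? c x a) ≤ 5
  blocked-≤5 {c = c} δ≥2 Iax cx≡nothing with degᴴ-cases Iax
  ... | inj₁ d≡1        = ≤-trans (≤-reflexive (blocked-at-leaf {c = c} d≡1 Iax)) z≤n
  ... | inj₂ (inj₁ d≡2) = ≤-trans (blocked-at-degree-two {c = c} δ≥2 d≡2 Iax cx≡nothing) (m≤m+n 2 3)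
  ... | inj₂ (inj₂ 3≤d) = blocked-at-big-end-≤5 {c = c} 3≤d Iax cx≡nothing

  blocked-≤3 : ThinUncoloured c → degᴴ a ≢ 2 → Incident a x → Uncoloured c x → count (blocked? c x a) ≤ 3
  blocked-≤3 {c = c} thin-uncoloured d≢2 Iax cx≡nothing with degᴴ-cases Iax
  ... | inj₁ d≡1        = ≤-trans (≤-reflexive (blocked-at-leaf {c = c} d≡1 Iax)) z≤n
  ... | inj₂ (inj₁ d≡2) = contradiction d≡2 d≢2
  ... | inj₂ (inj₂ 3≤d) = blocked-at-big-end-≤3 thin-uncoloured 3≤d Iax cx≡nothing

  module _ (δ≥2 : ∀ x → 2 ≤ deg x) where

    extend-non-thin : {c : PartialColouring n 8} → ¬ Thin x → Uncoloured c x →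
                      Balanced c × ThinUncoloured c →
                      ∃ λ α → Balanced (c [ x ↦ α ]) × ThinUncoloured (c [ x ↦ α ])
    extend-non-thin {x = x} {c = c} ¬thin cx≡nothing (bal , thin-uncoloured) =
      let α , free = free-colour {c = c} (joins x) few
      in  α , extend-balanced bal cx≡nothing free , still-uncoloured
      where
      at-end : Incident a x → count (blocked? c x a) ≤ 3
      at-end {a = a} Iax = blocked-≤3 {c = c} thin-uncoloured (λ d≡2 → ¬thin (a , Iax , d≡2)) Iax cx≡nothing
      few : count (blocked? c x (p x)) + count (blocked? c x (q x)) < 8
      few = s≤s (≤-trans (+-mono-≤ (at-end (inj₁ refl)) (at-end (inj₂ refl))) (n≤1+n 6))
      still-uncoloured : ∀ {α} → ThinUncoloured (c [ x ↦ α ])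
      still-uncoloured {α} thin-y =
        trans ([↦]-elsewhere {c = c} {α = α} (λ { refl → ¬thin thin-y })) (thin-uncoloured thin-y)

    extend-thin : {c : PartialColouring n 8} → Thin x → Uncoloured c x → Balanced c →
                  ∃ λ α → Balanced (c [ x ↦ α ])
    extend-thin {x = x} {c = c} (a , Iax , d≡2) cx≡nothing bal with incident-joins Iax
    ... | b , j = let α , free = free-colour {c = c} j few in α , extend-balanced bal cx≡nothing free
      where
      few : count (blocked? c x a) + count (blocked? c x b) < 8
      few = s≤s (+-mono-≤ (blocked-at-degree-two {c = c} δ≥2 d≡2 Iax cx≡nothing)
                          (blocked-≤5 {c = c} δ≥2 (proj₂ (joins-incident j)) cx≡nothing))

    balanced-colouring : ∃ λ (c : PartialColouring n 8) → Balanced c × (∀ x → Coloured c x)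
    balanced-colouring
      with Greedy.colour-all {Inv = λ c → Balanced c × ThinUncoloured c} (∁? thin?) extend-non-thin
                             (balanced-empty , λ _ → refl)
    ... | c₁ , (bal₁ , _) , _ , coloured₁ with Greedy.colour-all {Inv = Balanced} thin? extend-thin bal₁
    ...   | c₂ , bal₂ , c₁⊑c₂ , coloured₂ = c₂ , bal₂ , coloured
      where
      coloured : ∀ x → Coloured c₂ x
      coloured x with thin? x
      ... | yes thin = coloured₂ thin
      ... | no ¬thin = let β , c₁x≡β = coloured₁ ¬thin in β , c₁⊑c₂ c₁x≡β

    majority-colouring : MajAtMost G 8
    majority-colouring with balanced-colouring
    ... | c , bal , coloured = χ , majority
      where
      χ : Fin n → Fin 8
      χ x = proj₁ (coloured x)
      majority : IsStrongMajorityColouring G χ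
      majority x α = subst₂ (λ u v → 2 * u ≤ v)
        (sym (colourCount≡countAround c χ (proj₂ ∘ coloured) x α)) (sym (degree≡deg x))
        (balanced⇒majority bal x α)

corollary1 : ∀ n (G : Graph n) → IsLineGraph G → MinDegreeAtLeast G 2 → MajAtMost G 8
corollary1 n G (m , H , L) δ≥2 = majority-colouring (λ x → subst (2 ≤_) (degree≡deg x) (δ≥2 x))
  where open LineGraph G H L
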